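{- Let $\bar w,\bar x,\bar y,\bar z$ be sorted (non-increasing) binary sequences and $k$ an integer with $1\le k\le s=|\bar w|+|\bar x|+|\bar y|+|\bar z|$ and $k\ge|\bar w|\ge|\bar x|\ge|\bar y|\ge|\bar z|$. Then the output of $oe\_4merge^s_k(\bar w,\bar x,\bar y,\bar z)$ is top $k$ sorted.
   Context: A sequence is sorted if non-increasing; $\bar{u}$ of length $s$ is top $k$ sorted if $\langle u_1,\dots,u_k\rangle$ is sorted and each of $u_1,\dots,u_k$ is $\ge$ each of $u_{k+1},\dots,u_s$. For a sequence $\bar u$: $\bar u_{\mathit{odd}}=\langle u_1,u_3,\dots\rangle$, $\bar u_{\mathit{even}}=\langle u_2,u_4,\dots\rangle$, $\mathrm{pref}(i,\bar u)=\langle u_1,\dots,u_i\rangle$, $\mathrm{suff}(i,\bar u)=\langle u_i,\dots,u_{|\bar u|}\rangle$; $::$ is concatenation. The combine procedure $oe\_4combine(\bar x,\bar y)$ on sequences $\bar x,\bar y$ outputs $\langle a_1,\dots,a_{|\bar x|+|\bar y|}\rangle$ where, with $x(i)=0$ if $i>|\bar x|$ else $x_i$, $y(i)=1$ if $i<1$, $0$ if $i>|\bar y|$, else $y_i$, and $i=\lceil j/2\rceil$: $a_j=\max(\max(x(i+2),y(i)),\min(x(i+1),y(i-1)))$ for even $j$ and $a_j=\min(\max(x(i+1),y(i-1)),\min(x(i),y(i-2)))$ for odd $j$. $oe\_4merge^s_k(\bar w,\bar x,\bar y,\bar z)$ (inputs as in the claim) is defined recursively: if $|\bar x|=0$, output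 $\bar w$. If $|\bar w|=1$, output the elements of $\bar w::\bar x::\bar y::\bar z$ sorted non-increasingly. Otherwise let $s_a=\sum\lceil|\cdot|/2\rceil$ and $s_b=\sum\lfloor|\cdot|/2\rfloor$ over the four sequences, $k_a=\min(s_a,\lfloor k/2\rfloor+2)$, $k_b=\min(s_b,\lfloor k/2\rfloor)$, $\bar a=oe\_4merge^{s_a}_{k_a}(\bar w_{\mathit{odd}},\bar x_{\mathit{odd}},\bar y_{\mathit{odd}},\bar z_{\mathit{odd}})$, $\bar b=oe\_4merge^{s_b}_{k_b}(\bar w_{\mathit{even}},\bar x_{\mathit{even}},\bar y_{\mathit{even}},\bar z_{\mathit{even}})$, and output $oe\_4combine(\mathrm{pref}(k_a,\bar a),\mathrm{pref}(k_b,\bar b))::\mathrm{suff}(k_a+1,\bar a)::\mathrm{suff}(k_b+1,\bar b)$. -}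

module Defs where

open import Data.Bool using (Bool; true; false; _∧_; _∨_; if_then_else_; _≤_)
open import Data.Nat as ℕ using (ℕ; zero; suc; _∸_; _<ᵇ_; _≤ᵇ_; ⌊_/2⌋; ⌈_/2⌉; _⊓_)
open import Data.List using (List; []; _∷_; _++_; length; map; upTo; take; drop; replicate; filter)
open import Data.List.Relation.Unary.Linked using (Linked)
open import Data.List.Membership.Propositional using (_∈_)
open import Data.Product using (_×_)
open import Relation.Unary using (Pred)

-- Binary values are Bool with false = 0, true = 1 (so max = _∨_, min = _∧_).

Sorted : List Bool → Set
Sorted = Linked (λ a b → b ≤ a)

TopSorted : ℕ → List Bool → Set
TopSorted k u = Sorted (take k u) × (∀ {a b} → a ∈ take k u → b ∈ drop k u → b ≤ a)

-- odd / even subsequences (1-based positions)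
odds evens : List Bool → List Bool
odds []       = []
odds (a ∷ u)  = a ∷ evens u
evens []      = []
evens (a ∷ u) = odds u

-- 1-based lookup with default value for out-of-range positions
at : Bool → List Bool → ℕ → Bool
at d []      _             = d
at d (a ∷ u) zero          = d   -- never used (positions are ≥ 1)
at d (a ∷ u) (suc zero)    = a
at d (a ∷ u) (suc (suc i)) = at d u (suc i)

xv : List Bool → ℕ → Bool
xv x i = at false x i

-- y(i ∸ d) in the integer sense: 1 if i - d < 1, 0 if i - d > |y|, else y_{i-d}
yv : List Bool → ℕ → ℕ → Bool
yv y i d = if i ≤ᵇ d then true else at false y (i ∸ d)

combineAt : List Bool → List Bool → ℕ → Bool
combineAt x y j with j ℕ.% 2
... | zero  = let i = ⌈ j /2⌉ in
              (xv x (i ℕ.+ 2) ∨ yv y i 0) ∨ (xv x (i ℕ.+ 1) ∧ yv y i 1)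
... | suc _ = let i = ⌈ j /2⌉ in
              (xv x (i ℕ.+ 1) ∨ yv y i 1) ∧ (xv x i ∧ yv y i 2)

oe4combine : List Bool → List Bool → List Bool
oe4combine x y = map (λ j → combineAt x y (suc j)) (upTo (length x ℕ.+ length y))

count : Bool → List Bool → ℕ
count b u = length (filter (λ c → Data.Bool._≟_ c b) u)
  where import Data.Bool

sortDesc : List Bool → List Bool
sortDesc u = replicate (count true u) true ++ replicate (count false u) false

-- oe_4merge with a fuel argument ensuring termination; fuel |w| suffices
-- (the recursion only happens when |w| ≥ 2, and ⌈|w|/2⌉ ≤ |w| - 1).
merge4 : ℕ → ℕ → ℕ → List Bool → List Bool → List Bool → List Bool → List Bool
merge4 f s k w [] y z = w
merge4 f s k (a ∷ []) x y z = sortDesc ((a ∷ []) ++ x ++ y ++ z)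
merge4 zero s k w x y z = w   -- unreachable when fuel ≥ |w|
merge4 (suc f) s k w x y z =
  oe4combine (take ka A) (take kb B) ++ drop ka A ++ drop kb B
  where
  sa = ⌈ length w /2⌉ ℕ.+ ⌈ length x /2⌉ ℕ.+ ⌈ length y /2⌉ ℕ.+ ⌈ length z /2⌉
  sb = ⌊ length w /2⌋ ℕ.+ ⌊ length x /2⌋ ℕ.+ ⌊ length y /2⌋ ℕ.+ ⌊ length z /2⌋
  ka = sa ⊓ (⌊ k /2⌋ ℕ.+ 2)
  kb = sb ⊓ ⌊ k /2⌋
  A = merge4 f sa ka (odds w) (odds x) (odds y) (odds z)
  B = merge4 f sb kb (evens w) (evens x) (evens y) (evens z)

oe4merge : ℕ → ℕ → List Bool → List Bool → List Bool → List Bool → List Bool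
oe4merge s k w x y z = merge4 (length w) s k w x y z

-- A sorted binary sequence is a block 1^c 0^m.  By induction along the recursion, the
-- output of oe_4merge^s_k has the length and the number of ones of its inputs, and it
-- either starts with k ones or is a block with fewer than k ones; both shapes are top k
-- sorted.  In the recursive step the
-- odd and even parts of the inputs are blocks with ⌈c/2⌉ and ⌊c/2⌋ ones, so the two
-- recursive outputs carry a and b ones with b ≤ a ≤ b + 4, and the same holds for their
-- lengths.  Hence their prefixes of lengths k_a and k_b are blocks whose numbers of ones
-- differ by at most 4, and on such blocks oe_4combine returns a block holding all their
-- ones.  If that block has fewer than k ones then, since k_a = ⌊k/2⌋ + 2 and k_b = ⌊k/2⌋
-- unless capped by the lengths, the prefixes already held every one of the recursive
-- outputs, so the appended suffixes consist of zeros.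
module Submission where

open import Defs
open import Data.Bool using (Bool; true; false; _∧_; _∨_; b≤b; f≤t) renaming (_≤_ to _≤B_)
open import Data.Bool.Properties using (∨-zeroʳ; _≟_; ≤-minimum; ≤-maximum)
import Data.Bool.Properties as Bool
open import Data.Nat using (ℕ; zero; suc; _≤_; _<_; _+_; _*_; _∸_; _⊓_; _≤ᵇ_; ⌊_/2⌋; ⌈_/2⌉; _%_; z≤n; s≤s; _≤?_; _<?_)
open import Data.Nat.Properties
  using ( +-comm; +-suc; +-identityʳ; +-cancelˡ-≡; +-cancelˡ-≤; +-mono-≤; +-monoʳ-≤; +-monoˡ-<; +-monoʳ-<
        ; ≤-refl; ≤-reflexive; ≤-trans; ≤-pred; <⇒≤; <⇒≱; ≰⇒>; ≮⇒≥; n≤1+n; n<1+n; m≤m+n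
        ; m+[n∸m]≡n; m≤n+o⇒m∸n≤o; m≤n⇒m∸n≡0
        ; ⊓-assoc; ⊓-glb; ⊓-mono-≤; m⊓n≤m; m⊓n≤n; m≤n⇒m⊓n≡m; m≥n⇒m⊓n≡n; +-distribʳ-⊓
        ; ⌊n/2⌋-mono; ⌈n/2⌉-mono; ⌊n/2⌋≤⌈n/2⌉; ⌊n/2⌋+⌈n/2⌉≡n; ⌊n/2⌋≤n; ⌈n/2⌉≤n
        ; module ≤-Reasoning )
open import Data.Nat.DivMod using (m*n%n≡0; [m+kn]%n≡m%n)
open import Data.Nat.Tactic.RingSolver using (solve-∀)
open import Data.List using (List; []; _∷_; _++_; length; map; replicate; filter; applyUpTo; upTo; take; drop)
open import Data.List.Properties
  using (length-++; length-replicate; length-map; length-upTo; filter-++; map-cong; map-upTo; ++-assoc; ++-identityʳ; take++drop≡id)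
open import Data.List.Relation.Unary.Linked using ([]; [-]; _∷_; tail)
open import Data.List.Relation.Unary.Linked.Properties using (AllPairs⇒Linked; Linked⇒AllPairs)
import Data.List.Relation.Unary.All as All
import Data.List.Relation.Unary.All.Properties as All
import Data.List.Relation.Unary.AllPairs.Properties as AllPairs
open import Data.List.Membership.Propositional using (_∈_)
open import Data.Product using (∃-syntax; _×_; _,_)
open import Function using (_∘_)
open import Relation.Nullary using (yes; no; contradiction)
open import Relation.Binary.PropositionalEquality

-- Sorted binary lists are blocks

block : ℕ → ℕ → List Bool
block c m = replicate c true ++ replicate m false

replicate-+ : ∀ m n (b : Bool) → replicate (m + n) b ≡ replicate m b ++ replicate n b
replicate-+ zero    n b = refl
replicate-+ (suc m) n b = cong (b ∷_) (replicate-+ m n b)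

count-++ : ∀ b u v → count b (u ++ v) ≡ count b u + count b v
count-++ b u v = trans (cong length (filter-++ (_≟ b) u v)) (length-++ (filter (_≟ b) u))

count-true-replicate-false : ∀ n → count true (replicate n false) ≡ 0
count-true-replicate-false zero    = refl
count-true-replicate-false (suc n) = count-true-replicate-false n

count-replicate-true-++ : ∀ n R → count true (replicate n true ++ R) ≡ n + count true R
count-replicate-true-++ zero    R = refl
count-replicate-true-++ (suc n) R = cong suc (count-replicate-true-++ n R)

count-block : ∀ c m → count true (block c m) ≡ c
count-block c m = trans (count-replicate-true-++ c (replicate m false))
                        (trans (cong (c +_) (count-true-replicate-false m)) (+-identityʳ c))

length-block : ∀ c m → length (block c m) ≡ c + m
length-block c m = trans (length-++ (replicate c true)) (cong₂ _+_ (length-replicate c) (length-replicate m))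

count-true+count-false : ∀ u → count true u + count false u ≡ length u
count-true+count-false []          = refl
count-true+count-false (true ∷ u)  = cong suc (count-true+count-false u)
count-true+count-false (false ∷ u) =
  trans (+-suc (count true u) (count false u)) (cong suc (count-true+count-false u))

count≤length : ∀ u → count true u ≤ length u
count≤length u = subst (count true u ≤_) (count-true+count-false u) (m≤m+n _ _)

count-true≡0 : ∀ u → count true u ≡ 0 → u ≡ replicate (length u) false
count-true≡0 []          _  = refl
count-true≡0 (false ∷ u) eq = cong (false ∷_) (count-true≡0 u eq)

replicate-sorted : ∀ n b → Sorted (replicate n b)
replicate-sorted zero          b = []
replicate-sorted (suc zero)    b = [-]
replicate-sorted (suc (suc n)) b = b≤b ∷ replicate-sorted (suc n) b

block-sorted : ∀ c m → Sorted (block c m)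
block-sorted zero          m       = replicate-sorted m false
block-sorted (suc zero)    zero    = [-]
block-sorted (suc zero)    (suc m) = f≤t ∷ replicate-sorted (suc m) false
block-sorted (suc (suc c)) m       = b≤b ∷ block-sorted (suc c) m

take-sorted : ∀ n {u} → Sorted u → Sorted (take n u)
take-sorted n = AllPairs⇒Linked ∘ AllPairs.take⁺ n ∘ Linked⇒AllPairs (λ p q → Bool.≤-trans q p)

count-true-after-false : ∀ {u} → Sorted (false ∷ u) → count true u ≡ 0
count-true-after-false [-]       = refl
count-true-after-false (b≤b ∷ s) = count-true-after-false s

Sorted⇒block : ∀ {u} → Sorted u → u ≡ block (count true u) (count false u)
Sorted⇒block {[]}        _ = refl
Sorted⇒block {true ∷ u}  s = cong (true ∷_) (Sorted⇒block (tail s))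
Sorted⇒block {false ∷ u} s with count true u | count-true-after-false s | Sorted⇒block (tail s)
... | .0 | refl | u≡block = cong (false ∷_) u≡block

IsBlock : ℕ → List Bool → Set
IsBlock c u = ∃[ m ] u ≡ block c m

IsBlock-sorted : ∀ {c u} → IsBlock c u → Sorted u
IsBlock-sorted {c} (m , refl) = block-sorted c m

IsBlock-count : ∀ {c u} → IsBlock c u → count true u ≡ c
IsBlock-count {c} (m , refl) = count-block c m

length-odds  : ∀ u → length (odds u) ≡ ⌈ length u /2⌉
length-evens : ∀ u → length (evens u) ≡ ⌊ length u /2⌋
length-odds  []      = refl
length-odds  (a ∷ u) = cong suc (length-evens u)
length-evens []      = refl
length-evens (a ∷ u) = length-odds u

length-odds≤length : ∀ u → length (odds u) ≤ length u
length-odds≤length u = subst (_≤ length u) (sym (length-odds u)) (⌈n/2⌉≤n (length u))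

length-evens≤length : ∀ u → length (evens u) ≤ length u
length-evens≤length u = subst (_≤ length u) (sym (length-evens u)) (⌊n/2⌋≤n (length u))

odds-replicate  : ∀ n (b : Bool) → odds (replicate n b) ≡ replicate ⌈ n /2⌉ b
evens-replicate : ∀ n (b : Bool) → evens (replicate n b) ≡ replicate ⌊ n /2⌋ b
odds-replicate  zero    b = refl
odds-replicate  (suc n) b = cong (b ∷_) (evens-replicate n b)
evens-replicate zero    b = refl
evens-replicate (suc n) b = odds-replicate n b

odds-block  : ∀ c m → IsBlock ⌈ c /2⌉ (odds (block c m))
evens-block : ∀ c m → IsBlock ⌊ c /2⌋ (evens (block c m))
odds-block zero    m = ⌈ m /2⌉ , odds-replicate m false
odds-block (suc c) m with evens-block c m
... | m′ , eq = m′ , cong (true ∷_) eq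
evens-block zero    m = ⌊ m /2⌋ , evens-replicate m false
evens-block (suc c) m = odds-block c m

odds-IsBlock : ∀ {u} → Sorted u → IsBlock ⌈ count true u /2⌉ (odds u)
odds-IsBlock {u} s = subst (λ v → IsBlock ⌈ count true u /2⌉ (odds v)) (sym (Sorted⇒block s))
                           (odds-block (count true u) (count false u))

evens-IsBlock : ∀ {u} → Sorted u → IsBlock ⌊ count true u /2⌋ (evens u)
evens-IsBlock {u} s = subst (λ v → IsBlock ⌊ count true u /2⌋ (evens v)) (sym (Sorted⇒block s))
                            (evens-block (count true u) (count false u))

-- oe_4combine on blocks

at-replicate-false : ∀ n i → at false (replicate n false) i ≡ false
at-replicate-false zero    i             = refl
at-replicate-false (suc n) zero          = refl
at-replicate-false (suc n) (suc zero)    = refl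
at-replicate-false (suc n) (suc (suc i)) = at-replicate-false n (suc i)

xv-block : ∀ p m n → xv (block p m) (suc n) ≡ (suc n ≤ᵇ p)
xv-block zero    m n       = at-replicate-false m (suc n)
xv-block (suc p) m zero    = refl
xv-block (suc p) m (suc n) = xv-block p m n

yv-block : ∀ q m n d → yv (block q m) n d ≡ (n ≤ᵇ d + q)
yv-block q m zero          d       = refl
yv-block q m (suc n)       zero    = xv-block q m n
yv-block q m (suc zero)    (suc d) = refl
yv-block q m (suc (suc n)) (suc d) = yv-block q m (suc n) d

⌈n*2/2⌉≡n : ∀ n → ⌈ n * 2 /2⌉ ≡ n
⌈n*2/2⌉≡n zero    = refl
⌈n*2/2⌉≡n (suc n) = cong suc (⌈n*2/2⌉≡n n)

⌊n*2/2⌋≡n : ∀ n → ⌊ n * 2 /2⌋ ≡ n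
⌊n*2/2⌋≡n zero    = refl
⌊n*2/2⌋≡n (suc n) = cong suc (⌊n*2/2⌋≡n n)

combineAt-even : ∀ x y i → combineAt x y (i * 2) ≡
  ((xv x (2 + i) ∨ yv y i 0) ∨ (xv x (1 + i) ∧ yv y i 1))
combineAt-even x y i with (i * 2) % 2 | m*n%n≡0 i 2
... | .0 | refl rewrite ⌈n*2/2⌉≡n i | +-comm i 2 | +-comm i 1 = refl

combineAt-odd : ∀ x y i → combineAt x y (suc (i * 2)) ≡
  ((xv x (2 + i) ∨ yv y (suc i) 1) ∧ (xv x (suc i) ∧ yv y (suc i) 2))
combineAt-odd x y i with suc (i * 2) % 2 | [m+kn]%n≡m%n 1 i 2
... | .1 | refl rewrite ⌊n*2/2⌋≡n i | +-comm i 1 = refl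

-- The entries at positions 2i + 2 and 2i + 1 when the blocks hold q + e and q ones.
-- Lowering i and q together reduces everything to q = 0, a finite table in i and e.
even-threshold : ∀ i q e → e ≤ 4 →
  (((3 + i ≤ᵇ q + e) ∨ (suc i ≤ᵇ q)) ∨ ((2 + i ≤ᵇ q + e) ∧ (suc i ≤ᵇ 1 + q))) ≡ (suc i * 2 ≤ᵇ q * 2 + e)
even-threshold zero    (suc q) e _   rewrite ∨-zeroʳ (3 ≤ᵇ suc q + e) = refl
even-threshold (suc i) (suc q) e e≤4 = even-threshold i q e e≤4
even-threshold i                   zero 0 _ = refl
even-threshold i                   zero 1 _ = refl
even-threshold zero                zero 2 _ = refl
even-threshold (suc i)             zero 2 _ = refl
even-threshold zero                zero 3 _ = refl
even-threshold (suc zero)          zero 3 _ = refl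
even-threshold (suc (suc i))       zero 3 _ = refl
even-threshold zero                zero 4 _ = refl
even-threshold (suc zero)          zero 4 _ = refl
even-threshold (suc (suc zero))    zero 4 _ = refl
even-threshold (suc (suc (suc i))) zero 4 _ = refl
even-threshold i zero (suc (suc (suc (suc (suc e))))) (s≤s (s≤s (s≤s (s≤s ()))))

odd-threshold : ∀ i q e → e ≤ 4 →
  (((2 + i ≤ᵇ q + e) ∨ (suc i ≤ᵇ 1 + q)) ∧ ((suc i ≤ᵇ q + e) ∧ (suc i ≤ᵇ 2 + q))) ≡ (suc (i * 2) ≤ᵇ q * 2 + e)
odd-threshold zero    (suc q) e _   rewrite ∨-zeroʳ (2 ≤ᵇ suc q + e) = refl
odd-threshold (suc i) (suc q) e e≤4 = odd-threshold i q e e≤4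
odd-threshold zero                zero 0 _ = refl
odd-threshold (suc i)             zero 0 _ = refl
odd-threshold zero                zero 1 _ = refl
odd-threshold (suc i)             zero 1 _ = refl
odd-threshold zero                zero 2 _ = refl
odd-threshold (suc i)             zero 2 _ = refl
odd-threshold zero                zero 3 _ = refl
odd-threshold (suc zero)          zero 3 _ = refl
odd-threshold (suc (suc i))       zero 3 _ = refl
odd-threshold zero                zero 4 _ = refl
odd-threshold (suc zero)          zero 4 _ = refl
odd-threshold (suc (suc zero))    zero 4 _ = refl
odd-threshold (suc (suc (suc i))) zero 4 _ = refl
odd-threshold i zero (suc (suc (suc (suc (suc e))))) (s≤s (s≤s (s≤s (s≤s ()))))

data Parity : ℕ → Set where
  even : ∀ i → Parity (suc i * 2)
  odd  : ∀ i → Parity (suc (i * 2))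

parity : ∀ n → Parity (suc n)
parity zero = odd 0
parity (suc n) with parity n
... | even i = odd (suc i)
... | odd  i = even i

combineAt-block : ∀ q e m₁ m₂ → e ≤ 4 → ∀ n →
  combineAt (block (q + e) m₁) (block q m₂) (suc n) ≡ (suc n ≤ᵇ q * 2 + e)
combineAt-block q e m₁ m₂ e≤4 n with parity n
... | even i
  rewrite combineAt-even (block (q + e) m₁) (block q m₂) (suc i)
        | xv-block (q + e) m₁ (2 + i) | xv-block (q + e) m₁ (1 + i)
        | yv-block q m₂ (suc i) 0 | yv-block q m₂ (suc i) 1
        = even-threshold i q e e≤4
... | odd i
  rewrite combineAt-odd (block (q + e) m₁) (block q m₂) i
        | xv-block (q + e) m₁ (1 + i) | xv-block (q + e) m₁ i
        | yv-block q m₂ (suc i) 1 | yv-block q m₂ (suc i) 2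
        = odd-threshold i q e e≤4

applyUpTo-const : ∀ {A : Set} (a : A) n → applyUpTo (λ _ → a) n ≡ replicate n a
applyUpTo-const a zero    = refl
applyUpTo-const a (suc n) = cong (a ∷_) (applyUpTo-const a n)

applyUpTo-≤ᵇ : ∀ t m → applyUpTo (λ n → suc n ≤ᵇ t) (t + m) ≡ block t m
applyUpTo-≤ᵇ zero    m = applyUpTo-const false m
applyUpTo-≤ᵇ (suc t) m = cong (true ∷_) (applyUpTo-≤ᵇ t m)

Balanced : ℕ → ℕ → Set
Balanced a b = b ≤ a × a ≤ b + 4

combine-block : ∀ {p q} m₁ m₂ → Balanced p q →
  oe4combine (block p m₁) (block q m₂) ≡ block (p + q) (m₁ + m₂)
combine-block {p} {q} m₁ m₂ (q≤p , p≤q+4) =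
  subst (λ p → oe4combine (block p m₁) (block q m₂) ≡ block (p + q) (m₁ + m₂))
        (m+[n∸m]≡n q≤p) (combine-excess (p ∸ q) (m≤n+o⇒m∸n≤o p q p≤q+4))
  where
  combine-excess : ∀ e → e ≤ 4 → oe4combine (block (q + e) m₁) (block q m₂) ≡ block ((q + e) + q) (m₁ + m₂)
  combine-excess e e≤4 = begin
    map (λ n → combineAt X Y (suc n)) (upTo (length X + length Y))
      ≡⟨ map-cong (combineAt-block q e m₁ m₂ e≤4) _ ⟩
    map (λ n → suc n ≤ᵇ t) (upTo (length X + length Y))
      ≡⟨ map-upTo _ _ ⟩
    applyUpTo (λ n → suc n ≤ᵇ t) (length X + length Y)
      ≡⟨ cong (applyUpTo _) (trans (cong₂ _+_ (length-block (q + e) m₁) (length-block q m₂)) (lengths q e m₁ m₂)) ⟩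
    applyUpTo (λ n → suc n ≤ᵇ t) (t + (m₁ + m₂))
      ≡⟨ applyUpTo-≤ᵇ t (m₁ + m₂) ⟩
    block t (m₁ + m₂)
      ≡⟨ cong (λ t → block t (m₁ + m₂)) (ones q e) ⟩
    block ((q + e) + q) (m₁ + m₂) ∎
    where
    open ≡-Reasoning
    X = block (q + e) m₁
    Y = block q m₂
    t = q * 2 + e
    lengths : ∀ q e m₁ m₂ → (q + e + m₁) + (q + m₂) ≡ (q * 2 + e) + (m₁ + m₂)
    lengths = solve-∀
    ones : ∀ q e → q * 2 + e ≡ (q + e) + q
    ones = solve-∀

length-oe4combine : ∀ X Y → length (oe4combine X Y) ≡ length X + length Y
length-oe4combine X Y =
  trans (length-map (λ j → combineAt X Y (suc j)) (upTo (length X + length Y))) (length-upTo (length X + length Y))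

-- Lists whose top k part is sorted

data TopBlock (k : ℕ) : List Bool → Set where
  saturated : ∀ R → TopBlock k (replicate k true ++ R)
  short     : ∀ {t} m → t < k → TopBlock k (block t m)

TopBlock-cons : ∀ {k u} → TopBlock k u → TopBlock (suc k) (true ∷ u)
TopBlock-cons (saturated R) = saturated R
TopBlock-cons (short m t<k) = short m (s≤s t<k)

TopBlock-ones : ∀ {k c} R → k ≤ c → TopBlock k (replicate c true ++ R)
TopBlock-ones {c = c} R z≤n       = saturated (replicate c true ++ R)
TopBlock-ones         R (s≤s k≤c) = TopBlock-cons (TopBlock-ones R k≤c)

TopBlock-block : ∀ k c m → TopBlock k (block c m)
TopBlock-block k c m with c <? k
... | yes c<k = short m c<k
... | no  c≮k = TopBlock-ones (replicate m false) (≮⇒≥ c≮k)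

take-replicate : ∀ {n m} (b : Bool) → n ≤ m → take n (replicate m b) ≡ replicate n b
take-replicate b z≤n       = refl
take-replicate b (s≤s n≤m) = cong (b ∷_) (take-replicate b n≤m)

take-replicate-++ : ∀ n (b : Bool) R → take n (replicate n b ++ R) ≡ replicate n b
take-replicate-++ zero    b R = refl
take-replicate-++ (suc n) b R = cong (b ∷_) (take-replicate-++ n b R)

drop-replicate : ∀ n m (b : Bool) → drop n (replicate m b) ≡ replicate (m ∸ n) b
drop-replicate zero    m       b = refl
drop-replicate (suc n) zero    b = refl
drop-replicate (suc n) (suc m) b = drop-replicate n m b

take-block : ∀ {n} t m → t ≤ n → n ≤ t + m → take n (block t m) ≡ block t (n ∸ t)
take-block zero    m _         n≤m         = take-replicate false n≤m
take-block (suc t) m (s≤s t≤n) (s≤s n≤t+m) = cong (true ∷_) (take-block t m t≤n n≤t+m)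

drop-short-block : ∀ {k t} m → t < k → drop k (block t m) ≡ replicate (m ∸ (k ∸ t)) false
drop-short-block {suc k} {zero}  m _         = drop-replicate (suc k) m false
drop-short-block {suc k} {suc t} m (s≤s t<k) = drop-short-block m t<k

∈-replicate⁻ : ∀ {a b : Bool} n → a ∈ replicate n b → a ≡ b
∈-replicate⁻ {b = b} n = All.lookup (All.replicate⁺ {P = _≡ b} n refl)

TopBlock⇒TopSorted : ∀ {k u} → TopBlock k u → TopSorted k u
TopBlock⇒TopSorted {k} (saturated R) rewrite take-replicate-++ k true R =
  replicate-sorted k true , λ a∈ _ → subst (_ ≤B_) (sym (∈-replicate⁻ k a∈)) (≤-maximum _)
TopBlock⇒TopSorted {k} (short {t} m t<k) rewrite drop-short-block m t<k =
  take-sorted k (block-sorted t m) , λ _ b∈ → subst (_≤B _) (sym (∈-replicate⁻ _ b∈)) (≤-minimum _)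

take-TopBlock : ∀ {n A} → TopBlock n A → n ≤ length A →
  take n A ≡ block (n ⊓ count true A) (n ∸ count true A)
take-TopBlock {n} (saturated R) _
  rewrite take-replicate-++ n true R | count-replicate-true-++ n R
        | m≤n⇒m⊓n≡m (m≤m+n n (count true R)) | m≤n⇒m∸n≡0 (m≤m+n n (count true R))
        = sym (++-identityʳ (replicate n true))
take-TopBlock {n} (short {t} m t<n) n≤length
  rewrite count-block t m | m≥n⇒m⊓n≡n (<⇒≤ t<n)
        = take-block t m (<⇒≤ t<n) (subst (n ≤_) (length-block t m) n≤length)

count-take-TopBlock : ∀ {n A} → TopBlock n A → n ≤ length A → count true (take n A) ≡ n ⊓ count true A
count-take-TopBlock {n} {A} top n≤length =
  trans (cong (count true) (take-TopBlock top n≤length)) (count-block _ (n ∸ count true A))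

combine-prefixes : ℕ → ℕ → List Bool → List Bool → List Bool
combine-prefixes m n A B = oe4combine (take m A) (take n B) ++ drop m A ++ drop n B

total : (List Bool → ℕ) → List Bool → List Bool → List Bool → List Bool → ℕ
total f w x y z = f w + f x + f y + f z

module _ (f : List Bool → ℕ) (f-++ : ∀ u v → f (u ++ v) ≡ f u + f v) where

  additive-take+drop : ∀ n u → f (take n u) + f (drop n u) ≡ f u
  additive-take+drop n u = trans (sym (f-++ (take n u) (drop n u))) (cong f (take++drop≡id n u))

  additive-combine-prefixes : ∀ m n A B →
    f (oe4combine (take m A) (take n B)) ≡ f (take m A) + f (take n B) →
    f (combine-prefixes m n A B) ≡ f A + f B
  additive-combine-prefixes m n A B f-combine = begin
    f (C ++ drop m A ++ drop n B)                                  ≡⟨ f-++ C _ ⟩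
    f C + f (drop m A ++ drop n B)                                 ≡⟨ cong₂ _+_ f-combine (f-++ (drop m A) (drop n B)) ⟩
    (f (take m A) + f (take n B)) + (f (drop m A) + f (drop n B)) ≡⟨ interchange (f (take m A)) (f (take n B)) (f (drop m A)) (f (drop n B)) ⟩
    (f (take m A) + f (drop m A)) + (f (take n B) + f (drop n B)) ≡⟨ cong₂ _+_ (additive-take+drop m A) (additive-take+drop n B) ⟩
    f A + f B                                                      ∎
    where
    open ≡-Reasoning
    C = oe4combine (take m A) (take n B)
    interchange : ∀ a b c d → (a + b) + (c + d) ≡ (a + c) + (b + d)
    interchange = solve-∀

  additive-++₄ : ∀ w x y z → f (w ++ x ++ y ++ z) ≡ total f w x y z
  additive-++₄ w x y z = begin
    f (w ++ x ++ y ++ z)      ≡⟨ f-++ w _ ⟩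
    f w + f (x ++ y ++ z)     ≡⟨ cong (f w +_) (f-++ x _) ⟩
    f w + (f x + f (y ++ z))  ≡⟨ cong (λ n → f w + (f x + n)) (f-++ y z) ⟩
    f w + (f x + (f y + f z)) ≡⟨ reassoc (f w) (f x) (f y) (f z) ⟩
    total f w x y z           ∎
    where
    open ≡-Reasoning
    reassoc : ∀ a b c d → a + (b + (c + d)) ≡ a + b + c + d
    reassoc = solve-∀

total-cong : ∀ (f g : List Bool → ℕ) w x y z → f w ≡ g w → f x ≡ g x → f y ≡ g y → f z ≡ g z →
  total f w x y z ≡ total g w x y z
total-cong _ _ _ _ _ _ eq-w eq-x eq-y eq-z = cong₂ _+_ (cong₂ _+_ (cong₂ _+_ eq-w eq-x) eq-y) eq-z

total-mono-≤ : ∀ {f g : List Bool → ℕ} w x y z → (∀ u → f u ≤ g u) → total f w x y z ≤ total g w x y z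
total-mono-≤ w x y z f≤g = +-mono-≤ (+-mono-≤ (+-mono-≤ (f≤g w) (f≤g x)) (f≤g y)) (f≤g z)

total-halves : ∀ (f : List Bool → ℕ) w x y z →
  total (λ u → ⌊ f u /2⌋) w x y z + total (λ u → ⌈ f u /2⌉) w x y z ≡ total f w x y z
total-halves f w x y z =
  trans (interleave ⌊ f w /2⌋ ⌊ f x /2⌋ ⌊ f y /2⌋ ⌊ f z /2⌋ ⌈ f w /2⌉ ⌈ f x /2⌉ ⌈ f y /2⌉ ⌈ f z /2⌉)
        (total-cong (λ u → ⌊ f u /2⌋ + ⌈ f u /2⌉) f w x y z
                    (⌊n/2⌋+⌈n/2⌉≡n (f w)) (⌊n/2⌋+⌈n/2⌉≡n (f x)) (⌊n/2⌋+⌈n/2⌉≡n (f y)) (⌊n/2⌋+⌈n/2⌉≡n (f z)))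
  where
  interleave : ∀ a b c d a′ b′ c′ d′ →
    (a + b + c + d) + (a′ + b′ + c′ + d′) ≡ (a + a′) + (b + b′) + (c + c′) + (d + d′)
  interleave = solve-∀

⌈n/2⌉≤1+⌊n/2⌋ : ∀ n → ⌈ n /2⌉ ≤ suc ⌊ n /2⌋
⌈n/2⌉≤1+⌊n/2⌋ zero          = z≤n
⌈n/2⌉≤1+⌊n/2⌋ (suc zero)    = s≤s z≤n
⌈n/2⌉≤1+⌊n/2⌋ (suc (suc n)) = s≤s (⌈n/2⌉≤1+⌊n/2⌋ n)

k≤⌊k/2⌋+1+⌊k/2⌋ : ∀ k → k ≤ ⌊ k /2⌋ + suc ⌊ k /2⌋
k≤⌊k/2⌋+1+⌊k/2⌋ k = ≤-trans (≤-reflexive (sym (⌊n/2⌋+⌈n/2⌉≡n k))) (+-monoʳ-≤ ⌊ k /2⌋ (⌈n/2⌉≤1+⌊n/2⌋ k))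

total-halves-balanced : ∀ (f : List Bool → ℕ) w x y z →
  Balanced (total (λ u → ⌈ f u /2⌉) w x y z) (total (λ u → ⌊ f u /2⌋) w x y z)
total-halves-balanced f w x y z =
  total-mono-≤ w x y z (λ u → ⌊n/2⌋≤⌈n/2⌉ (f u)) ,
  ≤-trans (total-mono-≤ w x y z (λ u → ⌈n/2⌉≤1+⌊n/2⌋ (f u)))
          (≤-reflexive (four-sucs ⌊ f w /2⌋ ⌊ f x /2⌋ ⌊ f y /2⌋ ⌊ f z /2⌋))
  where
  four-sucs : ∀ a b c d → suc a + suc b + suc c + suc d ≡ (a + b + c + d) + 4
  four-sucs = solve-∀

Balanced-⊓ : ∀ {a b c d} → Balanced a b → Balanced c d → Balanced (a ⊓ c) (b ⊓ d)
Balanced-⊓ {b = b} {d = d} (b≤a , a≤b+4) (d≤c , c≤d+4) =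
  ⊓-mono-≤ b≤a d≤c , ≤-trans (⊓-mono-≤ a≤b+4 c≤d+4) (≤-reflexive (sym (+-distribʳ-⊓ 4 b d)))

-- The only place where the prefix lengths ⌊k/2⌋ + 2 and ⌊k/2⌋ matter.
prefixes-hold-all-ones : ∀ {h a b} → Balanced a b → (h + 2) ⊓ a + h ⊓ b ≤ h + h → a ≤ h + 2 × b ≤ h
prefixes-hold-all-ones {h} {a} {b} (b≤a , a≤b+4) bound = a≤h+2 , b≤h
  where
  open ≤-Reasoning

  b≤h : b ≤ h
  b≤h = ≮⇒≥ λ h<b → <⇒≱ (begin-strict
    h + h               <⟨ +-monoˡ-< h (n<1+n h) ⟩
    suc h + h           ≤⟨ +-mono-≤ (⊓-glb (≤-trans (n≤1+n (suc h)) (≤-reflexive (+-comm 2 h))) (≤-trans h<b b≤a))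
                                    (≤-reflexive (sym (m≤n⇒m⊓n≡m (<⇒≤ h<b)))) ⟩
    (h + 2) ⊓ a + h ⊓ b ∎) bound

  h≤1+b : h + 2 < a → h ≤ suc b
  h≤1+b h+2<a = +-cancelˡ-≤ 3 h (suc b) (begin
    3 + h       ≡⟨ cong suc (+-comm 2 h) ⟩
    suc (h + 2) ≤⟨ ≤-trans h+2<a a≤b+4 ⟩
    b + 4       ≡⟨ +-comm b 4 ⟩
    3 + suc b   ∎)

  a≤h+2 : a ≤ h + 2
  a≤h+2 = ≮⇒≥ λ h+2<a → <⇒≱ (begin-strict
    h + h                 <⟨ +-monoʳ-< h (s≤s (⊓-glb (n≤1+n h) (h≤1+b h+2<a))) ⟩
    h + suc (suc (h ⊓ b)) ≡⟨ shift h (h ⊓ b) ⟩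
    (h + 2) + h ⊓ b       ≡⟨ cong (_+ h ⊓ b) (m≤n⇒m⊓n≡m (<⇒≤ h+2<a)) ⟨
    (h + 2) ⊓ a + h ⊓ b   ∎) bound
    where
    shift : ∀ m n → m + suc (suc n) ≡ (m + 2) + n
    shift = solve-∀

m≤n⇒[n⊓o]⊓m≡o⊓m : ∀ {m n} o → m ≤ n → (n ⊓ o) ⊓ m ≡ o ⊓ m
m≤n⇒[n⊓o]⊓m≡o⊓m {m} {n} o m≤n = trans (⊓-assoc n o m) (m≥n⇒m⊓n≡n (≤-trans (m⊓n≤n o m) m≤n))

drop-TopBlock-falses : ∀ {n U} → TopBlock n U → n ≤ length U → count true U ≤ n →
  drop n U ≡ replicate (length (drop n U)) false
drop-TopBlock-falses {n} {U} top n≤length ones≤n =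
  count-true≡0 (drop n U) (+-cancelˡ-≡ (count true U) _ 0 (begin
    count true U + count true (drop n U)          ≡⟨ cong (_+ count true (drop n U)) (m≥n⇒m⊓n≡n ones≤n) ⟨
    n ⊓ count true U + count true (drop n U)      ≡⟨ cong (_+ count true (drop n U)) (count-take-TopBlock top n≤length) ⟨
    count true (take n U) + count true (drop n U) ≡⟨ additive-take+drop (count true) (count-++ true) n U ⟩
    count true U                                  ≡⟨ +-identityʳ (count true U) ⟨
    count true U + 0                              ∎))
  where open ≡-Reasoning

-- The recursive step

module CombinePrefixes (k : ℕ) {sa sb : ℕ} {A B : List Bool}
  (|A|≡sa : length A ≡ sa) (|B|≡sb : length B ≡ sb)
  (balanced-lengths : Balanced sa sb) (balanced-counts : Balanced (count true A) (count true B))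
  (top-A : TopBlock (sa ⊓ (⌊ k /2⌋ + 2)) A) (top-B : TopBlock (sb ⊓ ⌊ k /2⌋) B) where

  private
    h  = ⌊ k /2⌋
    ka = sa ⊓ (h + 2)
    kb = sb ⊓ h
    a  = count true A
    b  = count true B
    T  = ka ⊓ a + kb ⊓ b
    Z  = (ka ∸ a) + (kb ∸ b)

    ka≤|A| : ka ≤ length A
    ka≤|A| = subst (ka ≤_) (sym |A|≡sa) (m⊓n≤m sa (h + 2))

    kb≤|B| : kb ≤ length B
    kb≤|B| = subst (kb ≤_) (sym |B|≡sb) (m⊓n≤m sb h)

    a≤sa : a ≤ sa
    a≤sa = subst (a ≤_) |A|≡sa (count≤length A)

    b≤sb : b ≤ sb
    b≤sb = subst (b ≤_) |B|≡sb (count≤length B)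

    balanced-prefixes : Balanced (ka ⊓ a) (kb ⊓ b)
    balanced-prefixes = Balanced-⊓ (Balanced-⊓ balanced-lengths (m≤m+n h 2 , +-monoʳ-≤ h (s≤s (s≤s z≤n)))) balanced-counts

    combine-takes : oe4combine (take ka A) (take kb B) ≡ block T Z
    combine-takes = trans (cong₂ oe4combine (take-TopBlock top-A ka≤|A|) (take-TopBlock top-B kb≤|B|))
                          (combine-block (ka ∸ a) (kb ∸ b) balanced-prefixes)

    combine-prefixes≡ : combine-prefixes ka kb A B ≡ replicate T true ++ (replicate Z false ++ drop ka A ++ drop kb B)
    combine-prefixes≡ = trans (cong (_++ drop ka A ++ drop kb B) combine-takes) (++-assoc (replicate T true) _ _)

    ones-within-prefixes : T < k → a ≤ ka × b ≤ kb
    ones-within-prefixes T<k with prefixes-hold-all-ones {h} balanced-counts bound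
      where
      bound : (h + 2) ⊓ a + h ⊓ b ≤ h + h
      bound = ≤-pred (begin
        suc ((h + 2) ⊓ a + h ⊓ b) ≡⟨ cong₂ (λ p q → suc (p + q)) (m≤n⇒[n⊓o]⊓m≡o⊓m (h + 2) a≤sa) (m≤n⇒[n⊓o]⊓m≡o⊓m h b≤sb) ⟨
        suc T                     ≤⟨ T<k ⟩
        k                         ≤⟨ k≤⌊k/2⌋+1+⌊k/2⌋ k ⟩
        h + suc h                 ≡⟨ +-suc h h ⟩
        suc (h + h) ∎)
        where open ≤-Reasoning
    ... | a≤h+2 , b≤h = ⊓-glb a≤sa a≤h+2 , ⊓-glb b≤sb b≤h

  count-combine-prefixes : count true (combine-prefixes ka kb A B) ≡ a + b
  count-combine-prefixes = additive-combine-prefixes (count true) (count-++ true) ka kb A B (begin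
    count true (oe4combine (take ka A) (take kb B)) ≡⟨ cong (count true) combine-takes ⟩
    count true (block T Z)                          ≡⟨ count-block T Z ⟩
    T                                               ≡⟨ cong₂ _+_ (count-take-TopBlock top-A ka≤|A|) (count-take-TopBlock top-B kb≤|B|) ⟨
    count true (take ka A) + count true (take kb B) ∎)
    where open ≡-Reasoning

  TopBlock-combine-prefixes : TopBlock k (combine-prefixes ka kb A B)
  TopBlock-combine-prefixes with k ≤? T
  ... | yes k≤T = subst (TopBlock k) (sym combine-prefixes≡) (TopBlock-ones _ k≤T)
  ... | no  k≰T = subst (TopBlock k) (sym out≡block) (short _ T<k)
    where
    T<k : T < k
    T<k = ≰⇒> k≰T
    out≡block : combine-prefixes ka kb A B ≡ block T (Z + (length (drop ka A) + length (drop kb B)))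
    out≡block with ones-within-prefixes T<k
    ... | a≤ka , b≤kb = begin
      combine-prefixes ka kb A B
        ≡⟨ combine-prefixes≡ ⟩
      replicate T true ++ (replicate Z false ++ drop ka A ++ drop kb B)
        ≡⟨ cong₂ (λ u v → replicate T true ++ (replicate Z false ++ u ++ v))
                 (drop-TopBlock-falses top-A ka≤|A| a≤ka) (drop-TopBlock-falses top-B kb≤|B| b≤kb) ⟩
      replicate T true ++ (replicate Z false ++ replicate |dA| false ++ replicate |dB| false)
        ≡⟨ cong (λ u → replicate T true ++ (replicate Z false ++ u)) (replicate-+ |dA| |dB| false) ⟨
      replicate T true ++ (replicate Z false ++ replicate (|dA| + |dB|) false)
        ≡⟨ cong (replicate T true ++_) (replicate-+ Z (|dA| + |dB|) false) ⟨
      block T (Z + (|dA| + |dB|)) ∎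
      where
      open ≡-Reasoning
      |dA| = length (drop ka A)
      |dB| = length (drop kb B)

record MergeInputs (w x y z : List Bool) : Set where
  field
    w-sorted : Sorted w
    x-sorted : Sorted x
    y-sorted : Sorted y
    z-sorted : Sorted z
    |x|≤|w|  : length x ≤ length w
    |y|≤|x|  : length y ≤ length x
    |z|≤|y|  : length z ≤ length y

MergeInputs-odds : ∀ {w x y z} → MergeInputs w x y z → MergeInputs (odds w) (odds x) (odds y) (odds z)
MergeInputs-odds {w} {x} {y} {z} ins = record
  { w-sorted = IsBlock-sorted (odds-IsBlock w-sorted)
  ; x-sorted = IsBlock-sorted (odds-IsBlock x-sorted)
  ; y-sorted = IsBlock-sorted (odds-IsBlock y-sorted)
  ; z-sorted = IsBlock-sorted (odds-IsBlock z-sorted)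
  ; |x|≤|w|  = mono x w |x|≤|w|
  ; |y|≤|x|  = mono y x |y|≤|x|
  ; |z|≤|y|  = mono z y |z|≤|y|
  }
  where
  open MergeInputs ins
  mono : ∀ u v → length u ≤ length v → length (odds u) ≤ length (odds v)
  mono u v = subst₂ _≤_ (sym (length-odds u)) (sym (length-odds v)) ∘ ⌈n/2⌉-mono

MergeInputs-evens : ∀ {w x y z} → MergeInputs w x y z → MergeInputs (evens w) (evens x) (evens y) (evens z)
MergeInputs-evens {w} {x} {y} {z} ins = record
  { w-sorted = IsBlock-sorted (evens-IsBlock w-sorted)
  ; x-sorted = IsBlock-sorted (evens-IsBlock x-sorted)
  ; y-sorted = IsBlock-sorted (evens-IsBlock y-sorted)
  ; z-sorted = IsBlock-sorted (evens-IsBlock z-sorted)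
  ; |x|≤|w|  = mono x w |x|≤|w|
  ; |y|≤|x|  = mono y x |y|≤|x|
  ; |z|≤|y|  = mono z y |z|≤|y|
  }
  where
  open MergeInputs ins
  mono : ∀ u v → length u ≤ length v → length (evens u) ≤ length (evens v)
  mono u v = subst₂ _≤_ (sym (length-evens u)) (sym (length-evens v)) ∘ ⌊n/2⌋-mono

record Merged (k : ℕ) (w x y z out : List Bool) : Set where
  field
    length-out : length out ≡ total length w x y z
    count-out  : count true out ≡ total (count true) w x y z
    top        : TopBlock k out

k-odd k-even : ℕ → List Bool → List Bool → List Bool → List Bool → ℕ
k-odd  k w x y z = total (λ u → ⌈ length u /2⌉) w x y z ⊓ (⌊ k /2⌋ + 2)
k-even k w x y z = total (λ u → ⌊ length u /2⌋) w x y z ⊓ ⌊ k /2⌋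

count-odds : ∀ {u} → Sorted u → count true (odds u) ≡ ⌈ count true u /2⌉
count-odds = IsBlock-count ∘ odds-IsBlock

count-evens : ∀ {u} → Sorted u → count true (evens u) ≡ ⌊ count true u /2⌋
count-evens = IsBlock-count ∘ evens-IsBlock

total-length-odds : ∀ w x y z → total (length ∘ odds) w x y z ≡ total (λ u → ⌈ length u /2⌉) w x y z
total-length-odds w x y z =
  total-cong (length ∘ odds) _ w x y z (length-odds w) (length-odds x) (length-odds y) (length-odds z)

total-length-evens : ∀ w x y z → total (length ∘ evens) w x y z ≡ total (λ u → ⌊ length u /2⌋) w x y z
total-length-evens w x y z =
  total-cong (length ∘ evens) _ w x y z (length-evens w) (length-evens x) (length-evens y) (length-evens z)

total-count-odds : ∀ {w x y z} → MergeInputs w x y z →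
  total (count true ∘ odds) w x y z ≡ total (λ u → ⌈ count true u /2⌉) w x y z
total-count-odds {w} {x} {y} {z} ins = total-cong (count true ∘ odds) _ w x y z
  (count-odds w-sorted) (count-odds x-sorted) (count-odds y-sorted) (count-odds z-sorted)
  where open MergeInputs ins

total-count-evens : ∀ {w x y z} → MergeInputs w x y z →
  total (count true ∘ evens) w x y z ≡ total (λ u → ⌊ count true u /2⌋) w x y z
total-count-evens {w} {x} {y} {z} ins = total-cong (count true ∘ evens) _ w x y z
  (count-evens w-sorted) (count-evens x-sorted) (count-evens y-sorted) (count-evens z-sorted)
  where open MergeInputs ins

merged-step : ∀ k {w x y z A B} → MergeInputs w x y z →
  Merged (k-odd k w x y z) (odds w) (odds x) (odds y) (odds z) A →
  Merged (k-even k w x y z) (evens w) (evens x) (evens y) (evens z) B →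
  Merged k w x y z (combine-prefixes (k-odd k w x y z) (k-even k w x y z) A B)
merged-step k {w} {x} {y} {z} {A} {B} ins merged-A merged-B = record
  { length-out = begin
      length (combine-prefixes ka kb A B) ≡⟨ additive-combine-prefixes length (λ u _ → length-++ u) ka kb A B
                                                                      (length-oe4combine (take ka A) (take kb B)) ⟩
      length A + length B                 ≡⟨ cong₂ _+_ |A|≡sa |B|≡sb ⟩
      sa + sb                             ≡⟨ +-comm sa sb ⟩
      sb + sa                             ≡⟨ total-halves length w x y z ⟩
      total length w x y z                ∎
  ; count-out  = begin
      count true (combine-prefixes ka kb A B) ≡⟨ count-combine-prefixes ⟩
      count true A + count true B             ≡⟨ cong₂ _+_ #A≡ca #B≡cb ⟩
      ca + cb                                 ≡⟨ +-comm ca cb ⟩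
      cb + ca                                 ≡⟨ total-halves (count true) w x y z ⟩
      total (count true) w x y z              ∎
  ; top        = TopBlock-combine-prefixes
  }
  where
  open ≡-Reasoning
  sa = total (λ u → ⌈ length u /2⌉) w x y z
  sb = total (λ u → ⌊ length u /2⌋) w x y z
  ca = total (λ u → ⌈ count true u /2⌉) w x y z
  cb = total (λ u → ⌊ count true u /2⌋) w x y z
  ka = k-odd k w x y z
  kb = k-even k w x y z

  |A|≡sa : length A ≡ sa
  |A|≡sa = trans (Merged.length-out merged-A) (total-length-odds w x y z)

  |B|≡sb : length B ≡ sb
  |B|≡sb = trans (Merged.length-out merged-B) (total-length-evens w x y z)

  #A≡ca : count true A ≡ ca
  #A≡ca = trans (Merged.count-out merged-A) (total-count-odds ins)

  #B≡cb : count true B ≡ cb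
  #B≡cb = trans (Merged.count-out merged-B) (total-count-evens ins)

  open CombinePrefixes k |A|≡sa |B|≡sb (total-halves-balanced length w x y z)
         (subst₂ Balanced (sym #A≡ca) (sym #B≡cb) (total-halves-balanced (count true) w x y z))
         (Merged.top merged-A) (Merged.top merged-B)

merge4-correct : ∀ f s k w x y z → MergeInputs w x y z → length w ≤ f → Merged k w x y z (merge4 f s k w x y z)
merge4-correct f s k w [] [] [] ins _ = record
  { length-out = +0+0+0 (length w)
  ; count-out  = +0+0+0 (count true w)
  ; top        = subst (TopBlock k) (sym (Sorted⇒block (MergeInputs.w-sorted ins)))
                       (TopBlock-block k (count true w) (count false w))
  }
  where
  +0+0+0 : ∀ n → n ≡ n + 0 + 0 + 0
  +0+0+0 = solve-∀
merge4-correct f s k w [] (_ ∷ _) z ins _ = contradiction (MergeInputs.|y|≤|x| ins) λ ()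
merge4-correct f s k w [] [] (_ ∷ _) ins _ = contradiction (MergeInputs.|z|≤|y| ins) λ ()
merge4-correct f s k [] (_ ∷ _) y z ins _ = contradiction (MergeInputs.|x|≤|w| ins) λ ()
merge4-correct f s k (a ∷ []) (b ∷ x) y z ins _ = record
  { length-out = begin
      length (block (count true u) (count false u)) ≡⟨ length-block (count true u) (count false u) ⟩
      count true u + count false u                  ≡⟨ count-true+count-false u ⟩
      length u                                      ≡⟨ additive-++₄ length (λ v _ → length-++ v) (a ∷ []) (b ∷ x) y z ⟩
      total length (a ∷ []) (b ∷ x) y z             ∎
  ; count-out  = trans (count-block (count true u) (count false u))
                       (additive-++₄ (count true) (count-++ true) (a ∷ []) (b ∷ x) y z)
  ; top        = TopBlock-block k (count true u) (count false u)
  }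
  where
  open ≡-Reasoning
  u = (a ∷ []) ++ (b ∷ x) ++ y ++ z
merge4-correct zero    s k (a ∷ b ∷ w) (c ∷ x) y z ins ()
merge4-correct (suc f) s k W@(a ∷ b ∷ w) X@(c ∷ x) y z ins (s≤s 1+|w|≤f) =
  merged-step k ins
    (merge4-correct f (total (λ u → ⌈ length u /2⌉) W X y z) (k-odd k W X y z)
                    (odds W) (odds X) (odds y) (odds z)
                    (MergeInputs-odds ins) (≤-trans (s≤s (length-odds≤length w)) 1+|w|≤f))
    (merge4-correct f (total (λ u → ⌊ length u /2⌋) W X y z) (k-even k W X y z)
                    (evens W) (evens X) (evens y) (evens z)
                    (MergeInputs-evens ins) (≤-trans (s≤s (length-evens≤length w)) 1+|w|≤f))

mainTheorem17 : (w x y z : List Bool) (k : ℕ) →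
    Sorted w → Sorted x → Sorted y → Sorted z →
    1 ≤ k → k ≤ length w + length x + length y + length z →
    length w ≤ k → length x ≤ length w → length y ≤ length x → length z ≤ length y →
    TopSorted k (oe4merge (length w + length x + length y + length z) k w x y z)
mainTheorem17 w x y z k w-sorted x-sorted y-sorted z-sorted _ _ _ |x|≤|w| |y|≤|x| |z|≤|y| =
  TopBlock⇒TopSorted (Merged.top (merge4-correct (length w) (total length w x y z) k w x y z inputs ≤-refl))
  where
  inputs : MergeInputs w x y z
  inputs = record
    { w-sorted = w-sorted ; x-sorted = x-sorted ; y-sorted = y-sorted ; z-sorted = z-sorted
    ; |x|≤|w| = |x|≤|w| ; |y|≤|x| = |y|≤|x| ; |z|≤|y| = |z|≤|y| }
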